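{- Let $k$ be a positive integer and let $D$ be a digraph with no isolated vertex. Then $\gamma_{trk}(D)\le (k+1)\gamma(D)$. Moreover, if $\gamma_{trk}(D)=(k+1)\gamma(D)$, then every $\gamma(D)$-set is a packing in $D$.
   Context: All digraphs are finite, without loops or multiple arcs (pairs of opposite arcs are allowed). For a vertex $v$, $N^+(v)$ and $N^-(v)$ are the sets of out-neighbors and in-neighbors of $v$, $N^+[v]=N^+(v)\cup\{v\}$, and for $S\subseteq V(D)$, $N^+[S]=\bigcup_{v\in S}N^+[v]$. A vertex is isolated if it has no in- or out-neighbors. A set $S\subseteq V(D)$ is a dominating set if $N^+[S]=V(D)$; $\gamma(D)$ is the minimum cardinality of a dominating set, and a dominating set of cardinality $\gamma(D)$ is a $\gamma(D)$-set. A set $S$ is a packing if $N^+[u]\cap N^+[v]=\emptyset$ for all distinct $u,v\in S$. A $k$-rainbow dominating function ($k$RDF) on $D$ is a function $f:V(D)\to\mathcal{P}(\{1,\dots,k\})$ such that every vertex $v$ with $f(v)=\emptyset$ satisfies $\bigcup_{u\in N^-(v)}f(u)=\{1,\dots,k\}$; its weight is $\omega(f)=\sum_{v\in V(D)}|f(v)|$. For a digraph $D$ with no isolated vertex, a total $k$-rainbow dominating function (T$k$RDF) is a $k$RDF $f$ such that the subdigraph of $D$ induced by $\{v: f(v)\neq\emptyset\}$ has no isolated vertex; $\gamma_{trk}(D)$ is the minimum weight of a T$k$RDF on $D$. -}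

module Defs where

open import Data.Nat using (ℕ; _≤_; _+_)
open import Data.Bool using (Bool; true; false; T)
open import Data.Fin using (Fin)
open import Data.Fin.Subset using (Subset; _∈_; _∉_; ⊤; Empty; Nonempty; ∣_∣; _∪_; ⋃)
open import Data.Vec using (Vec; tabulate; foldr)
open import Data.Product using (Σ; ∃; _×_; _,_)
open import Data.Sum using (_⊎_)
open import Relation.Binary.PropositionalEquality using (_≡_; _≢_)
open import Relation.Nullary using (¬_)

-- A digraph on vertex set Fin n: Arc u v means there is an arc u → v.
-- No loops; multiple arcs impossible by construction; opposite arcs allowed.
record Digraph (n : ℕ) : Set where
  field
    Arc : Fin n → Fin n → Bool
    loopless : ∀ v → Arc v v ≡ false
open Digraph public

module _ {n : ℕ} (D : Digraph n) where

  _⟶_ : Fin n → Fin n → Set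
  u ⟶ v = T (Arc D u v)

  ClosedOut : Fin n → Fin n → Set
  ClosedOut u v = (u ≡ v) ⊎ (u ⟶ v)

  Isolated : Fin n → Set
  Isolated v = (∀ u → ¬ (v ⟶ u)) × (∀ u → ¬ (u ⟶ v))

  NoIsolated : Set
  NoIsolated = ∀ v → ¬ Isolated v

  Dominating : Subset n → Set
  Dominating S = ∀ v → ∃ λ u → u ∈ S × ClosedOut u v

  IsDomNumber : ℕ → Set
  IsDomNumber g = (∃ λ S → Dominating S × ∣ S ∣ ≡ g)
                × (∀ S → Dominating S → g ≤ ∣ S ∣)

  IsGammaSet : Subset n → Set
  IsGammaSet S = Dominating S × IsDomNumber ∣ S ∣

  Packing : Subset n → Set
  Packing S = ∀ u v → u ∈ S → v ∈ S → u ≢ v →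
              ∀ w → ¬ (ClosedOut u w × ClosedOut v w)

  module _ (k : ℕ) where

    Assignment : Set
    Assignment = Fin n → Subset k

    weight : Assignment → ℕ
    weight f = foldr (λ _ → ℕ) _+_ 0 (tabulate (λ v → ∣ f v ∣))

    IsKRDF : Assignment → Set
    IsKRDF f = ∀ v → Empty (f v) →
               ∀ (i : Fin k) → ∃ λ u → (u ⟶ v) × i ∈ f u

    -- subdigraph induced by {v : f v ≠ ∅} has no isolated vertex
    IsTKRDF : Assignment → Set
    IsTKRDF f = IsKRDF f ×
                (∀ v → Nonempty (f v) →
                  ∃ λ u → Nonempty (f u) × ((v ⟶ u) ⊎ (u ⟶ v)))

    IsTotalRainbowNumber : ℕ → Set
    IsTotalRainbowNumber t = (∃ λ f → IsTKRDF f × weight f ≡ t)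
                           × (∀ f → IsTKRDF f → t ≤ weight f)

-- Let S be a dominating set. Give every vertex of S all k colours and, for each x ∈ S,
-- give one fixed colour to a neighbour of x (one exists as D has no isolated vertex).
-- This is a total k-rainbow dominating function of weight at most (k+1)|S|. If two
-- vertices u ≠ v of S have a common vertex w in their closed out-neighbourhoods, then v
-- already has a labelled neighbour (u itself, or w after choosing w as the neighbour of
-- u), so v needs no labelled neighbour of its own and the weight drops below (k+1)|S|.
module Submission where

open import Defs
open import Data.Nat using (ℕ; zero; suc; _≤_; _<_; _+_; _*_; NonZero; z≤n; s≤s)
open import Data.Nat.Properties
  using (≤-trans; ≤-reflexive; <-irrefl; +-mono-≤; +-monoʳ-≤; +-suc; +-comm;
         +-identityʳ; *-comm; *-monoˡ-≤; +-commutativeSemigroup; module ≤-Reasoning)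
open import Algebra.Properties.CommutativeSemigroup +-commutativeSemigroup using (interchange)
open import Data.Bool using (true; false; _∨_)
open import Data.Bool.Properties using (T-∨)
open import Data.Fin using (Fin; zero; suc; _≟_)
open import Data.Fin.Properties using (any?)
open import Data.Fin.Subset using (Subset; _∈_; ⊤; ⊥; ⁅_⁆; _∪_; ⋃; ∣_∣; Nonempty)
open import Data.Fin.Subset.Properties
  using (∉⊥; ∣⊥∣≡0; ∈⊤; ∣⊤∣≡n; x∈⁅x⁆; ∣⁅x⁆∣≡1; x∈p∪q⁻; x∈p∪q⁺; ∣p∣≤∣x∷p∣)
open import Data.Vec as Vec using ([]; _∷_; tabulate)
open import Data.Vec.Functional using (updateAt)
open import Data.Vec.Functional.Properties using (updateAt-updates; updateAt-minimal)
open import Data.List using (List; []; _∷_; length; map)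
open import Data.List.Properties using (length-map)
open import Data.Nat.ListAction using (sum)
open import Data.List.Relation.Unary.Any using (Any; here; there)
open import Data.List.Relation.Unary.Any.Properties using (map⁺; map⁻)
open import Data.List.Membership.Propositional using (find; lose) renaming (_∈_ to _∈ₗ_)
open import Data.List.Membership.Propositional.Properties using (∈-map⁺; ∈-map⁻)
open import Data.Product using (∃; _×_; _,_; proj₁; proj₂)
open import Data.Sum using (_⊎_; inj₁; inj₂; swap)
open import Function.Bundles using (Equivalence)
open import Relation.Nullary using (yes; no; contradiction)
open import Relation.Nullary.Decidable using (T?)
open import Relation.Binary.PropositionalEquality
  using (_≡_; _≢_; refl; sym; trans; cong; cong₂; subst; ≢-sym)

∣p∪q∣≤∣p∣+∣q∣ : ∀ {k} (p q : Subset k) → ∣ p ∪ q ∣ ≤ ∣ p ∣ + ∣ q ∣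
∣p∪q∣≤∣p∣+∣q∣ [] [] = z≤n
∣p∪q∣≤∣p∣+∣q∣ (true ∷ p) (b ∷ q) =
  s≤s (≤-trans (∣p∪q∣≤∣p∣+∣q∣ p q) (+-monoʳ-≤ ∣ p ∣ (∣p∣≤∣x∷p∣ b q)))
∣p∪q∣≤∣p∣+∣q∣ (false ∷ p) (true ∷ q) =
  ≤-trans (s≤s (∣p∪q∣≤∣p∣+∣q∣ p q)) (≤-reflexive (sym (+-suc ∣ p ∣ ∣ q ∣)))
∣p∪q∣≤∣p∣+∣q∣ (false ∷ p) (false ∷ q) = ∣p∪q∣≤∣p∣+∣q∣ p q

∈⋃⁺ : ∀ {k} {ps : List (Subset k)} {i} → Any (i ∈_) ps → i ∈ ⋃ ps
∈⋃⁺ (here i∈p) = x∈p∪q⁺ (inj₁ i∈p)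
∈⋃⁺ {ps = p ∷ _} (there i∈⋃) = x∈p∪q⁺ {p = p} (inj₂ (∈⋃⁺ i∈⋃))

∈⋃⁻ : ∀ {k} (ps : List (Subset k)) {i} → i ∈ ⋃ ps → Any (i ∈_) ps
∈⋃⁻ [] i∈⊥ = contradiction i∈⊥ ∉⊥
∈⋃⁻ (p ∷ ps) i∈p∪⋃ with x∈p∪q⁻ p (⋃ ps) i∈p∪⋃
... | inj₁ i∈p = here i∈p
... | inj₂ i∈⋃ = there (∈⋃⁻ ps i∈⋃)

elements : ∀ {n} → Subset n → List (Fin n)
elements [] = []
elements (true ∷ p) = zero ∷ map suc (elements p)
elements (false ∷ p) = map suc (elements p)

length-elements : ∀ {n} (p : Subset n) → length (elements p) ≡ ∣ p ∣
length-elements [] = refl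
length-elements (true ∷ p) = cong suc (trans (length-map suc (elements p)) (length-elements p))
length-elements (false ∷ p) = trans (length-map suc (elements p)) (length-elements p)

∈-elements⁺ : ∀ {n} (p : Subset n) {x} → x ∈ p → x ∈ₗ elements p
∈-elements⁺ (true ∷ p) Vec.here = here refl
∈-elements⁺ (true ∷ p) (Vec.there x∈p) = there (∈-map⁺ suc (∈-elements⁺ p x∈p))
∈-elements⁺ (false ∷ p) (Vec.there x∈p) = ∈-map⁺ suc (∈-elements⁺ p x∈p)

∈-elements⁻ : ∀ {n} (p : Subset n) {x} → x ∈ₗ elements p → x ∈ p
∈-elements⁻ (true ∷ p) (here refl) = Vec.here
∈-elements⁻ (true ∷ p) (there x∈L) with ∈-map⁻ suc x∈L
... | _ , y∈L , refl = Vec.there (∈-elements⁻ p y∈L)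
∈-elements⁻ (false ∷ p) x∈L with ∈-map⁻ suc x∈L
... | _ , y∈L , refl = Vec.there (∈-elements⁻ p y∈L)

sum-map-≤ : ∀ {A : Set} (L : List A) (a : A → ℕ) {K} → (∀ x → a x ≤ K) →
            sum (map a L) ≤ length L * K
sum-map-≤ [] a a≤K = z≤n
sum-map-≤ (x ∷ L) a a≤K = +-mono-≤ (a≤K x) (sum-map-≤ L a a≤K)

sum-map-< : ∀ {A : Set} (L : List A) (a : A → ℕ) {K v} → v ∈ₗ L → a v < K → (∀ x → a x ≤ K) →
            sum (map a L) < length L * K
sum-map-< (x ∷ L) a (here refl) av<K a≤K = +-mono-≤ av<K (sum-map-≤ L a a≤K)
sum-map-< (x ∷ L) a (there v∈L) av<K a≤K =
  ≤-trans (≤-reflexive (sym (+-suc (a x) _))) (+-mono-≤ (a≤K x) (sum-map-< L a v∈L av<K a≤K))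

updateAt-preserves : ∀ {n} {A : Set} (R : Fin n → A → Set) (xs : Fin n → A) i {f : A → A} →
                     R i (f (xs i)) → (∀ j → R j (xs j)) → ∀ j → R j (updateAt xs i f j)
updateAt-preserves R xs i Rᵢ R-xs j with j ≟ i
... | yes refl = subst (R i) (sym (updateAt-updates i xs)) Rᵢ
... | no j≢i = subst (R j) (sym (updateAt-minimal j i xs j≢i)) (R-xs j)

-- Equal by definition to Defs.weight, which carries an unused digraph argument.
∑∣_∣ : ∀ {n k} → (Fin n → Subset k) → ℕ
∑∣ f ∣ = Vec.sum (tabulate (λ v → ∣ f v ∣))

∑∣⊥∣≡0 : ∀ n k → ∑∣ (λ (_ : Fin n) → ⊥ {k}) ∣ ≡ 0
∑∣⊥∣≡0 zero k = refl
∑∣⊥∣≡0 (suc n) k = cong₂ _+_ (∣⊥∣≡0 k) (∑∣⊥∣≡0 n k)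

∑∣∪∣≤ : ∀ {n k} (f g : Fin n → Subset k) → ∑∣ (λ v → f v ∪ g v) ∣ ≤ ∑∣ f ∣ + ∑∣ g ∣
∑∣∪∣≤ {zero} f g = z≤n
∑∣∪∣≤ {suc n} f g = begin
  ∣ f zero ∪ g zero ∣ + ∑∣ (λ v → f (suc v) ∪ g (suc v)) ∣
    ≤⟨ +-mono-≤ (∣p∪q∣≤∣p∣+∣q∣ (f zero) (g zero)) (∑∣∪∣≤ (λ v → f (suc v)) (λ v → g (suc v))) ⟩
  (∣ f zero ∣ + ∣ g zero ∣) + (∑∣ (λ v → f (suc v)) ∣ + ∑∣ (λ v → g (suc v)) ∣)
    ≡⟨ interchange ∣ f zero ∣ ∣ g zero ∣ _ _ ⟩
  ∑∣ f ∣ + ∑∣ g ∣ ∎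
  where open ≤-Reasoning

∑∣⋃∣≤ : ∀ {n k} {A : Set} (L : List A) (G : A → Fin n → Subset k) (a : A → ℕ) →
        (∀ x → ∑∣ G x ∣ ≤ a x) → ∑∣ (λ v → ⋃ (map (λ x → G x v) L)) ∣ ≤ sum (map a L)
∑∣⋃∣≤ {n} {k} [] G a G≤a = ≤-reflexive (∑∣⊥∣≡0 n k)
∑∣⋃∣≤ (x ∷ L) G a G≤a =
  ≤-trans (∑∣∪∣≤ (G x) (λ v → ⋃ (map (λ x → G x v) L))) (+-mono-≤ (G≤a x) (∑∣⋃∣≤ L G a G≤a))

point : ∀ {n k} → Fin n → Subset k → Fin n → Subset k
point x A = updateAt (λ _ → ⊥) x (λ _ → A)

∑∣point∣ : ∀ {n k} (x : Fin n) (A : Subset k) → ∑∣ point x A ∣ ≡ ∣ A ∣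
∑∣point∣ {suc n} {k} zero A = trans (cong (∣ A ∣ +_) (∑∣⊥∣≡0 n k)) (+-identityʳ ∣ A ∣)
∑∣point∣ {suc n} {k} (suc x) A = cong₂ _+_ (∣⊥∣≡0 k) (∑∣point∣ x A)

∈-point : ∀ {n k} (x : Fin n) {A : Subset k} {i} → i ∈ A → i ∈ point x A x
∈-point x i∈A = subst (_ ∈_) (sym (updateAt-updates x (λ _ → ⊥))) i∈A

point-support : ∀ {n k} (x y : Fin n) {A : Subset k} {i} → i ∈ point x A y → x ≡ y
point-support x y i∈ with x ≟ y
... | yes x≡y = x≡y
... | no x≢y = contradiction (subst (_ ∈_) (updateAt-minimal y x _ (≢-sym x≢y)) i∈) ∉⊥

module Labelling {n : ℕ} (D : Digraph n) {k : ℕ} where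

  Adjacent : Fin n → Fin n → Set
  Adjacent x y = (_⟶_ D x y) ⊎ (_⟶_ D y x)

  ∃-neighbour : NoIsolated D → ∀ x → ∃ (Adjacent x)
  ∃-neighbour noIsolated x with any? (λ y → T? (Arc D x y ∨ Arc D y x))
  ... | yes (y , x~y) = y , Equivalence.to T-∨ x~y
  ... | no ¬x~y = contradiction
    ((λ y x→y → ¬x~y (y , Equivalence.from T-∨ (inj₁ x→y))) ,
     (λ y y→x → ¬x~y (y , Equivalence.from T-∨ (inj₂ y→x))))
    (noIsolated x)

  label : Subset n → (Fin n → Fin n) → (Fin n → Subset k) → Assignment D k
  label S c B y = ⋃ (map (λ x → point x ⊤ y ∪ point (c x) (B x) y) (elements S))

  module _ {S : Subset n} {c : Fin n → Fin n} {B : Fin n → Subset k} where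

    label-⊤ : ∀ {x i} → x ∈ S → i ∈ label S c B x
    label-⊤ {x} x∈S =
      ∈⋃⁺ (map⁺ (lose (∈-elements⁺ S x∈S) (x∈p∪q⁺ (inj₁ (∈-point x ∈⊤)))))

    label-partner : ∀ {x i} → x ∈ S → i ∈ B x → i ∈ label S c B (c x)
    label-partner {x} x∈S i∈Bx =
      ∈⋃⁺ (map⁺ (lose (∈-elements⁺ S x∈S)
        (x∈p∪q⁺ {p = point x ⊤ (c x)} (inj₂ (∈-point (c x) i∈Bx)))))

    label-support : ∀ {y i} → i ∈ label S c B y → ∃ λ x → x ∈ S × (x ≡ y ⊎ c x ≡ y)
    label-support {y} i∈ with find (map⁻ (∈⋃⁻ _ i∈))
    ... | x , x∈L , i∈x with x∈p∪q⁻ (point x ⊤ y) (point (c x) (B x) y) i∈x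
    ...   | inj₁ i∈point = x , ∈-elements⁻ S x∈L , inj₁ (point-support x y i∈point)
    ...   | inj₂ i∈point = x , ∈-elements⁻ S x∈L , inj₂ (point-support (c x) y i∈point)

    label-weight : weight D k (label S c B) ≤ sum (map (λ x → k + ∣ B x ∣) (elements S))
    label-weight = ∑∣⋃∣≤ (elements S) (λ x y → point x ⊤ y ∪ point (c x) (B x) y) _ λ x → begin
      ∑∣ (λ y → point x ⊤ y ∪ point (c x) (B x) y) ∣
        ≤⟨ ∑∣∪∣≤ (point x ⊤) (point (c x) (B x)) ⟩
      ∑∣ point x ⊤ ∣ + ∑∣ point (c x) (B x) ∣
        ≡⟨ cong₂ _+_ (∑∣point∣ x ⊤) (∑∣point∣ (c x) (B x)) ⟩
      ∣ ⊤ {k} ∣ + ∣ B x ∣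
        ≡⟨ cong (_+ ∣ B x ∣) (∣⊤∣≡n k) ⟩
      k + ∣ B x ∣
        ∎
      where open ≤-Reasoning

  label-isTKRDF : ∀ {S c B} → Dominating D S → (∀ x → Adjacent x (c x)) →
                  (∀ {x} → x ∈ S → ∃ λ p → Adjacent x p × Nonempty (label S c B p)) →
                  IsTKRDF D k (label S c B)
  label-isTKRDF {S} {c} {B} dominating c-adjacent labelledNeighbour = rainbow , total
    where
    rainbow : IsKRDF D k (label S c B)
    rainbow y empty i with dominating y
    ... | x , x∈S , inj₁ refl = contradiction (i , label-⊤ x∈S) empty
    ... | x , x∈S , inj₂ x→y = x , x→y , label-⊤ x∈S

    total : ∀ y → Nonempty (label S c B y) →
            ∃ λ p → Nonempty (label S c B p) × ((_⟶_ D y p) ⊎ (_⟶_ D p y))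
    total y (i , i∈) with label-support i∈
    ... | x , x∈S , inj₁ refl =
      let p , x~p , p-labelled = labelledNeighbour x∈S in p , p-labelled , x~p
    ... | x , x∈S , inj₂ refl = x , (i , label-⊤ x∈S) , swap (c-adjacent x)

  -- B v = ∅: v needs no partner of its own, as its neighbour p is labelled on behalf of S anyway.
  labelledNeighbour⇒∃-tkrdf-< :
    ∀ {S v} → Dominating D S → Fin k → (c : Fin n → Fin n) → (∀ x → Adjacent x (c x)) →
    v ∈ S → (∃ λ p → Adjacent v p × (p ∈ S ⊎ ∃ λ x → x ∈ S × x ≢ v × c x ≡ p)) →
    ∃ λ f → IsTKRDF D k f × weight D k f < ∣ S ∣ * suc k
  labelledNeighbour⇒∃-tkrdf-< {S} {v} dominating i₀ c c-adjacent v∈S (p , v~p , p-labelled) =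
    label S c B , label-isTKRDF dominating c-adjacent labelledNeighbour , weight<
    where
    B : Fin n → Subset k
    B = updateAt (λ _ → ⁅ i₀ ⁆) v (λ _ → ⊥)
    i₀∈B : ∀ {x} → x ≢ v → i₀ ∈ B x
    i₀∈B {x} x≢v = subst (i₀ ∈_) (sym (updateAt-minimal x v _ x≢v)) (x∈⁅x⁆ i₀)
    labelledNeighbour : ∀ {x} → x ∈ S → ∃ λ q → Adjacent x q × Nonempty (label S c B q)
    labelledNeighbour {x} x∈S with x ≟ v
    ... | no x≢v = c x , c-adjacent x , i₀ , label-partner x∈S (i₀∈B x≢v)
    ... | yes refl = p , v~p , i₀ , i₀∈label p-labelled
      where
      i₀∈label : ∀ {q} → q ∈ S ⊎ (∃ λ y → y ∈ S × y ≢ v × c y ≡ q) → i₀ ∈ label S c B q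
      i₀∈label (inj₁ q∈S) = label-⊤ q∈S
      i₀∈label (inj₂ (y , y∈S , y≢v , refl)) = label-partner y∈S (i₀∈B y≢v)
    cost-v : k + ∣ B v ∣ < suc k
    cost-v = ≤-reflexive (cong suc (begin-equality
      k + ∣ B v ∣     ≡⟨ cong (λ A → k + ∣ A ∣) (updateAt-updates v _) ⟩
      k + ∣ ⊥ {k} ∣   ≡⟨ cong (k +_) (∣⊥∣≡0 k) ⟩
      k + 0           ≡⟨ +-identityʳ k ⟩
      k               ∎))
      where open ≤-Reasoning
    ∣B∣≤1 : ∀ x → ∣ B x ∣ ≤ 1
    ∣B∣≤1 = updateAt-preserves (λ _ A → ∣ A ∣ ≤ 1) _ v
              (≤-trans (≤-reflexive (∣⊥∣≡0 k)) z≤n) (λ _ → ≤-reflexive (∣⁅x⁆∣≡1 i₀))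
    cost≤ : ∀ x → k + ∣ B x ∣ ≤ suc k
    cost≤ x = ≤-trans (+-monoʳ-≤ k (∣B∣≤1 x)) (≤-reflexive (+-comm k 1))
    weight< : weight D k (label S c B) < ∣ S ∣ * suc k
    weight< = begin-strict
      weight D k (label S c B)                    ≤⟨ label-weight {S} {c} {B} ⟩
      sum (map (λ x → k + ∣ B x ∣) (elements S))
        <⟨ sum-map-< (elements S) _ (∈-elements⁺ S v∈S) cost-v cost≤ ⟩
      length (elements S) * suc k                 ≡⟨ cong (_* suc k) (length-elements S) ⟩
      ∣ S ∣ * suc k                               ∎
      where open ≤-Reasoning

  module _ (noIsolated : NoIsolated D) where

    neighbour : Fin n → Fin n
    neighbour x = proj₁ (∃-neighbour noIsolated x)

    neighbour-adjacent : ∀ x → Adjacent x (neighbour x)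
    neighbour-adjacent x = proj₂ (∃-neighbour noIsolated x)

    ∃-tkrdf-≤ : ∀ {S} → Dominating D S → Fin k →
                ∃ λ f → IsTKRDF D k f × weight D k f ≤ ∣ S ∣ * suc k
    ∃-tkrdf-≤ {S} dominating i₀ =
      label S neighbour B , label-isTKRDF dominating neighbour-adjacent labelledNeighbour , weight≤
      where
      B : Fin n → Subset k
      B _ = ⁅ i₀ ⁆
      labelledNeighbour : ∀ {x} → x ∈ S → ∃ λ p → Adjacent x p × Nonempty (label S neighbour B p)
      labelledNeighbour {x} x∈S =
        neighbour x , neighbour-adjacent x , i₀ , label-partner x∈S (x∈⁅x⁆ i₀)
      cost : k + ∣ ⁅ i₀ ⁆ ∣ ≤ suc k
      cost = ≤-reflexive (trans (cong (k +_) (∣⁅x⁆∣≡1 i₀)) (+-comm k 1))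
      weight≤ : weight D k (label S neighbour B) ≤ ∣ S ∣ * suc k
      weight≤ = begin
        weight D k (label S neighbour B)            ≤⟨ label-weight {S} {neighbour} {B} ⟩
        sum (map (λ x → k + ∣ B x ∣) (elements S))  ≤⟨ sum-map-≤ (elements S) _ (λ _ → cost) ⟩
        length (elements S) * suc k                 ≡⟨ cong (_* suc k) (length-elements S) ⟩
        ∣ S ∣ * suc k                               ∎
        where open ≤-Reasoning

    overlap⇒∃-tkrdf-< : ∀ {S u v w} → Dominating D S → Fin k →
                        u ∈ S → v ∈ S → u ≢ v → ClosedOut D u w → ClosedOut D v w →
                        ∃ λ f → IsTKRDF D k f × weight D k f < ∣ S ∣ * suc k
    overlap⇒∃-tkrdf-< {S} {u} {v} dominating i₀ u∈S v∈S u≢v = cases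
      where
      cases : ∀ {w} → ClosedOut D u w → ClosedOut D v w →
              ∃ λ f → IsTKRDF D k f × weight D k f < ∣ S ∣ * suc k
      cases (inj₁ refl) (inj₁ refl) = contradiction refl u≢v
      cases (inj₁ refl) (inj₂ v→u) =
        labelledNeighbour⇒∃-tkrdf-< dominating i₀ neighbour neighbour-adjacent v∈S
          (u , inj₁ v→u , inj₁ u∈S)
      cases (inj₂ u→v) (inj₁ refl) =
        labelledNeighbour⇒∃-tkrdf-< dominating i₀ neighbour neighbour-adjacent v∈S
          (u , inj₂ u→v , inj₁ u∈S)
      cases {w} (inj₂ u→w) (inj₂ v→w) =
        labelledNeighbour⇒∃-tkrdf-< dominating i₀ (updateAt neighbour u (λ _ → w))
          (updateAt-preserves Adjacent neighbour u (inj₁ u→w) neighbour-adjacent) v∈S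
          (w , inj₁ v→w , inj₂ (u , u∈S , u≢v , updateAt-updates u neighbour))

theorem2p1 : (k n : ℕ) → .{{_ : NonZero k}} → (D : Digraph n) → NoIsolated D →
             (g t : ℕ) → IsDomNumber D g → IsTotalRainbowNumber D k t →
             (t ≤ suc k * g) ×
             (t ≡ suc k * g → (S : Subset n) → IsGammaSet D S → Packing D S)
theorem2p1 zero n {{()}}
theorem2p1 k@(suc _) n D noIsolated g t ((S₀ , S₀-dominating , ∣S₀∣≡g) , _) (_ , γtr-minimal) =
  upper , packing
  where
  open Labelling D
  open ≤-Reasoning
  ∣S₀∣*suc-k≡ : ∣ S₀ ∣ * suc k ≡ suc k * g
  ∣S₀∣*suc-k≡ = trans (cong (_* suc k) ∣S₀∣≡g) (*-comm g (suc k))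

  upper : t ≤ suc k * g
  upper with ∃-tkrdf-≤ noIsolated S₀-dominating zero
  ... | f , f-tkrdf , f≤ = begin
    t               ≤⟨ γtr-minimal f f-tkrdf ⟩
    weight D k f    ≤⟨ f≤ ⟩
    ∣ S₀ ∣ * suc k  ≡⟨ ∣S₀∣*suc-k≡ ⟩
    suc k * g       ∎

  packing : t ≡ suc k * g → (S : Subset n) → IsGammaSet D S → Packing D S
  packing t≡ S (S-dominating , _ , S-minimal) u v u∈S v∈S u≢v w (u⇝w , v⇝w)
    with overlap⇒∃-tkrdf-< noIsolated S-dominating zero u∈S v∈S u≢v u⇝w v⇝w
  ... | f , f-tkrdf , f< = <-irrefl refl (begin-strict
    t               ≤⟨ γtr-minimal f f-tkrdf ⟩
    weight D k f    <⟨ f< ⟩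
    ∣ S ∣ * suc k   ≤⟨ *-monoˡ-≤ (suc k) (S-minimal S₀ S₀-dominating) ⟩
    ∣ S₀ ∣ * suc k  ≡⟨ trans ∣S₀∣*suc-k≡ (sym t≡) ⟩
    t               ∎)
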